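{- The theory $COMI_{fcn}+WPRA$ proves the iteration principle $ITER$: for every number $r$ and every unary function $h$ there is a unary function $f$ such that $f(0)=r$ and $(\forall n)(f(S(n))=h(f(n)))$.
   Context: The language $L_{fcn}$ is four-sorted: number variables ranging over $\omega$; function variables of arity 1, 2, 3 ranging over unary, binary, ternary functions on $\omega$; a constant $0$ and unary function symbol $S$ (successor). Terms are number variables, $0$, $S(t)$, and $f(t)$, $f(t,q)$, $f(t,q,r)$ for function variables of the corresponding arity; atomic formulas are equations of terms; formulas use connectives and quantifiers over numbers and functions of each arity. Free variables in axioms are read universally. $COMI_{fcn}$ consists of: (1) Successor axioms: $S(n)\neq 0$; $S(n)=S(m)\rightarrow n=m$; $n\neq 0\rightarrow(\exists m)(S(m)=n)$. (2) Initial function axioms: $(\exists f)(\forall m)(f(m)=n)$ ($f$ unary); ternary projections $(\exists f)(\forall m,n,r)(f(m,n,r)=m)$, and likewise with $=n$, $=r$; $(\exists f)(\forall n)(f(n)=S(n))$. (3) Composition axioms: (i) $(\exists f)(\forall m,n,r)(f(m,n,r)=g(m,n))$; (ii) $(\exists f)(\forall m,n,r)(f(m,n,r)=g(m))$; (iii) $(\exists f)(\forall m,n)(f(m,n)=g(m,n,r))$; (iv) $(\exists f)(\forall m)(f(m)=g(m,n,r))$; (v) $(\exists f)(\forall m,n,r)(f(m,n,r)=g(h_1(m,n,r),h_2(m,n,r),h_3(m,n,r)))$. (6) Rudimentary induction: for unary $f,g$: $f(0)=g(0)\wedge(\forall n)(f(n)=g(n)\rightarrow f(S(n))=g(S(n)))\rightarrow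 f(n)=g(n)$. $WPRA$ (weakened primitive recursion axiom): for unary $g$ and ternary $h$, $(\exists f)(\forall m)(f(m,0)=g(m)\wedge(\forall n)(f(m,S(n))=h(m,S(n),f(m,n))))$ with $f$ binary. -}

module Defs where

-- Deep embedding of the four-sorted language L_fcn, a classical natural
-- deduction calculus for it, the axioms of COMI_fcn + WPRA, and the
-- sentence ITER.  "T proves φ" is rendered as derivability of the closed
-- formula φ from no hypotheses, where axioms of T may be used at any point.

open import Data.List using (List; []; _∷_; map)
open import Data.List.Membership.Propositional using (_∈_)

data Sort : Set where
  num fn1 fn2 fn3 : Sort

Ctx : Set
Ctx = List Sort

data _∋_ : Ctx → Sort → Set where
  here  : ∀ {Γ s} → (s ∷ Γ) ∋ s
  there : ∀ {Γ s t} → Γ ∋ s → (t ∷ Γ) ∋ s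

data Tm (Γ : Ctx) : Sort → Set where
  var  : ∀ {s} → Γ ∋ s → Tm Γ s
  zro  : Tm Γ num
  suc  : Tm Γ num → Tm Γ num
  app1 : Tm Γ fn1 → Tm Γ num → Tm Γ num
  app2 : Tm Γ fn2 → Tm Γ num → Tm Γ num → Tm Γ num
  app3 : Tm Γ fn3 → Tm Γ num → Tm Γ num → Tm Γ num → Tm Γ num

infixr 6 _∧_
infixr 5 _⇒_
infix 8 _≐_

data Fm (Γ : Ctx) : Set where
  _≐_ : Tm Γ num → Tm Γ num → Fm Γ
  ⊥'  : Fm Γ
  _⇒_ : Fm Γ → Fm Γ → Fm Γ
  _∧_ : Fm Γ → Fm Γ → Fm Γ
  _∨_ : Fm Γ → Fm Γ → Fm Γ
  all : (s : Sort) → Fm (s ∷ Γ) → Fm Γ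
  ex  : (s : Sort) → Fm (s ∷ Γ) → Fm Γ

¬' : ∀ {Γ} → Fm Γ → Fm Γ
¬' A = A ⇒ ⊥'

Ren : Ctx → Ctx → Set
Ren Γ Δ = ∀ {s} → Γ ∋ s → Δ ∋ s

extR : ∀ {Γ Δ t} → Ren Γ Δ → Ren (t ∷ Γ) (t ∷ Δ)
extR ρ here      = here
extR ρ (there x) = there (ρ x)

renT : ∀ {Γ Δ s} → Ren Γ Δ → Tm Γ s → Tm Δ s
renT ρ (var x)        = var (ρ x)
renT ρ zro            = zro
renT ρ (suc t)        = suc (renT ρ t)
renT ρ (app1 f t)     = app1 (renT ρ f) (renT ρ t)
renT ρ (app2 f t q)   = app2 (renT ρ f) (renT ρ t) (renT ρ q)
renT ρ (app3 f t q r) = app3 (renT ρ f) (renT ρ t) (renT ρ q) (renT ρ r)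

renF : ∀ {Γ Δ} → Ren Γ Δ → Fm Γ → Fm Δ
renF ρ (t ≐ u)   = renT ρ t ≐ renT ρ u
renF ρ ⊥'        = ⊥'
renF ρ (A ⇒ B)   = renF ρ A ⇒ renF ρ B
renF ρ (A ∧ B)   = renF ρ A ∧ renF ρ B
renF ρ (A ∨ B)   = renF ρ A ∨ renF ρ B
renF ρ (all s A) = all s (renF (extR ρ) A)
renF ρ (ex s A)  = ex s (renF (extR ρ) A)

wkF : ∀ {Γ t} → Fm Γ → Fm (t ∷ Γ)
wkF = renF there

Sub : Ctx → Ctx → Set
Sub Γ Δ = ∀ {s} → Γ ∋ s → Tm Δ s

extS : ∀ {Γ Δ t} → Sub Γ Δ → Sub (t ∷ Γ) (t ∷ Δ)
extS σ here      = var here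
extS σ (there x) = renT there (σ x)

subT : ∀ {Γ Δ s} → Sub Γ Δ → Tm Γ s → Tm Δ s
subT σ (var x)        = σ x
subT σ zro            = zro
subT σ (suc t)        = suc (subT σ t)
subT σ (app1 f t)     = app1 (subT σ f) (subT σ t)
subT σ (app2 f t q)   = app2 (subT σ f) (subT σ t) (subT σ q)
subT σ (app3 f t q r) = app3 (subT σ f) (subT σ t) (subT σ q) (subT σ r)

subF : ∀ {Γ Δ} → Sub Γ Δ → Fm Γ → Fm Δ
subF σ (t ≐ u)   = subT σ t ≐ subT σ u
subF σ ⊥'        = ⊥'
subF σ (A ⇒ B)   = subF σ A ⇒ subF σ B
subF σ (A ∧ B)   = subF σ A ∧ subF σ B
subF σ (A ∨ B)   = subF σ A ∨ subF σ B
subF σ (all s A) = all s (subF (extS σ) A)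
subF σ (ex s A)  = ex s (subF (extS σ) A)

single : ∀ {Γ s} → Tm Γ s → Sub (s ∷ Γ) Γ
single t here      = t
single t (there x) = var x

_[_] : ∀ {Γ s} → Fm (s ∷ Γ) → Tm Γ s → Fm Γ
A [ t ] = subF (single t) A

noVar : ∀ {Γ} → Ren [] Γ
noVar ()

closedF : ∀ {Γ} → Fm [] → Fm Γ
closedF = renF noVar

-- Named de Bruijn variables (v0 = innermost bound variable)

v0 : ∀ {Γ a} → Tm (a ∷ Γ) a
v0 = var here
v1 : ∀ {Γ a b} → Tm (b ∷ a ∷ Γ) a
v1 = var (there here)
v2 : ∀ {Γ a b c} → Tm (c ∷ b ∷ a ∷ Γ) a
v2 = var (there (there here))
v3 : ∀ {Γ a b c d} → Tm (d ∷ c ∷ b ∷ a ∷ Γ) a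
v3 = var (there (there (there here)))
v4 : ∀ {Γ a b c d e} → Tm (e ∷ d ∷ c ∷ b ∷ a ∷ Γ) a
v4 = var (there (there (there (there here))))
v5 : ∀ {Γ a b c d e f} → Tm (f ∷ e ∷ d ∷ c ∷ b ∷ a ∷ Γ) a
v5 = var (there (there (there (there (there here)))))
v6 : ∀ {Γ a b c d e f g} → Tm (g ∷ f ∷ e ∷ d ∷ c ∷ b ∷ a ∷ Γ) a
v6 = var (there (there (there (there (there (there here))))))
v7 : ∀ {Γ a b c d e f g h} → Tm (h ∷ g ∷ f ∷ e ∷ d ∷ c ∷ b ∷ a ∷ Γ) a
v7 = var (there (there (there (there (there (there (there here)))))))

-- The axioms of COMI_fcn + WPRA, as sentences (free variables of the
-- informal axioms are universally closed, outermost first in the order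
-- they are listed in the comments).

data Ax : Fm [] → Set where
  succ0   : Ax (all num (¬' (suc v0 ≐ zro)))
  -- (1) S(n) = S(m) → n = m        [∀ n ∀ m]
  succInj : Ax (all num (all num (suc v1 ≐ suc v0 ⇒ v1 ≐ v0)))
  -- (1) n ≠ 0 → ∃ m (S(m) = n)
  succPred : Ax (all num (¬' (v0 ≐ zro) ⇒ ex num (suc v0 ≐ v1)))
  -- (2) ∀ n ∃ f ∀ m  f(m) = n
  const   : Ax (all num (ex fn1 (all num (app1 v1 v0 ≐ v2))))
  -- (2) ∃ f ∀ m n r  f(m,n,r) = m   (resp. = n, = r)
  proj1   : Ax (ex fn3 (all num (all num (all num (app3 v3 v2 v1 v0 ≐ v2)))))
  proj2   : Ax (ex fn3 (all num (all num (all num (app3 v3 v2 v1 v0 ≐ v1)))))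
  proj3   : Ax (ex fn3 (all num (all num (all num (app3 v3 v2 v1 v0 ≐ v0)))))
  succF   : Ax (ex fn1 (all num (app1 v1 v0 ≐ suc v0)))
  -- (3i) ∀ g ∃ f ∀ m n r  f(m,n,r) = g(m,n)
  compI   : Ax (all fn2 (ex fn3 (all num (all num (all num
              (app3 v3 v2 v1 v0 ≐ app2 v4 v2 v1))))))
  -- (3ii) ∀ g ∃ f ∀ m n r  f(m,n,r) = g(m)
  compII  : Ax (all fn1 (ex fn3 (all num (all num (all num
              (app3 v3 v2 v1 v0 ≐ app1 v4 v2))))))
  -- (3iii) ∀ g ∀ r ∃ f ∀ m n  f(m,n) = g(m,n,r)
  compIII : Ax (all fn3 (all num (ex fn2 (all num (all num
              (app2 v2 v1 v0 ≐ app3 v4 v1 v0 v3))))))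
  -- (3iv) ∀ g ∀ n ∀ r ∃ f ∀ m  f(m) = g(m,n,r)
  compIV  : Ax (all fn3 (all num (all num (ex fn1 (all num
              (app1 v1 v0 ≐ app3 v4 v0 v3 v2))))))
  -- (3v) ∀ g h1 h2 h3 ∃ f ∀ m n r
  --        f(m,n,r) = g(h1(m,n,r), h2(m,n,r), h3(m,n,r))
  compV   : Ax (all fn3 (all fn3 (all fn3 (all fn3 (ex fn3 (all num (all num (all num
              (app3 v3 v2 v1 v0 ≐
                app3 v7 (app3 v6 v2 v1 v0) (app3 v5 v2 v1 v0) (app3 v4 v2 v1 v0))))))))))
  -- (6) ∀ f g ∀ n
  --   f(0)=g(0) ∧ ∀ k (f(k)=g(k) → f(S k)=g(S k)) → f(n)=g(n)
  rind    : Ax (all fn1 (all fn1 (all num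
              ((app1 v2 zro ≐ app1 v1 zro
                ∧ all num (app1 v3 v0 ≐ app1 v2 v0 ⇒ app1 v3 (suc v0) ≐ app1 v2 (suc v0)))
               ⇒ app1 v2 v0 ≐ app1 v1 v0))))
  -- WPRA: ∀ g (unary) ∀ h (ternary) ∃ f (binary) ∀ m
  --   f(m,0) = g(m) ∧ ∀ n  f(m,S n) = h(m, S n, f(m,n))
  wpra    : Ax (all fn1 (all fn3 (ex fn2 (all num
              (app2 v1 v0 zro ≐ app1 v3 v0
               ∧ all num (app2 v2 v1 (suc v0) ≐ app3 v3 v1 (suc v0) (app2 v2 v1 v0)))))))

infix 3 _⊢_

data _⊢_ {Γ : Ctx} (Φ : List (Fm Γ)) : Fm Γ → Set where
  hyp   : ∀ {A} → A ∈ Φ → Φ ⊢ A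
  axiom : ∀ {φ} → Ax φ → Φ ⊢ closedF φ
  raa   : ∀ {A} → (¬' A ∷ Φ) ⊢ ⊥' → Φ ⊢ A
  ⇒I    : ∀ {A B} → (A ∷ Φ) ⊢ B → Φ ⊢ A ⇒ B
  ⇒E    : ∀ {A B} → Φ ⊢ A ⇒ B → Φ ⊢ A → Φ ⊢ B
  ∧I    : ∀ {A B} → Φ ⊢ A → Φ ⊢ B → Φ ⊢ A ∧ B
  ∧E₁   : ∀ {A B} → Φ ⊢ A ∧ B → Φ ⊢ A
  ∧E₂   : ∀ {A B} → Φ ⊢ A ∧ B → Φ ⊢ B
  ∨I₁   : ∀ {A B} → Φ ⊢ A → Φ ⊢ A ∨ B
  ∨I₂   : ∀ {A B} → Φ ⊢ B → Φ ⊢ A ∨ B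
  ∨E    : ∀ {A B C} → Φ ⊢ A ∨ B → (A ∷ Φ) ⊢ C → (B ∷ Φ) ⊢ C → Φ ⊢ C
  ∀I    : ∀ {s A} → map wkF Φ ⊢ A → Φ ⊢ all s A
  ∀E    : ∀ {s A} → Φ ⊢ all s A → (t : Tm Γ s) → Φ ⊢ A [ t ]
  ∃I    : ∀ {s A} → (t : Tm Γ s) → Φ ⊢ A [ t ] → Φ ⊢ ex s A
  ∃E    : ∀ {s A C} → Φ ⊢ ex s A → (A ∷ map wkF Φ) ⊢ wkF C → Φ ⊢ C
  ≐refl : ∀ {t} → Φ ⊢ t ≐ t
  ≐subst : ∀ {t u} (A : Fm (num ∷ Γ)) → Φ ⊢ t ≐ u → Φ ⊢ A [ t ] → Φ ⊢ A [ u ]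

Proves : Fm [] → Set
Proves φ = _⊢_ {[]} [] φ

ITER : Fm []
ITER = all num (all fn1 (ex fn1
         (app1 v0 zro ≐ v2
          ∧ all num (app1 v1 (suc v0) ≐ app1 v2 (app1 v1 v0)))))

-- WPRA with initial value the constant function r and step function
-- (m, n, x) ↦ h(x) yields a binary F with F(m, 0) = r and
-- F(m, S n) = h(F(m, n)); the required f is the section n ↦ F(0, n).
-- Composition (3iv) can only fix trailing arguments, so the arguments of F
-- are first swapped by composing with the projections.

module Submission where

open import Defs
open import Data.List using (List; _∷_)
open import Data.List.Relation.Unary.Any using (here; there)
open import Relation.Binary.PropositionalEquality using (_≡_; refl; sym; cong; cong₂; subst; subst₂)

variable
  Γ : Ctx
  Φ : List (Fm Γ)
  s : Sort
  A B C : Fm Γ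

wkT : Tm Γ s → Tm (num ∷ Γ) s
wkT = renT there

_⟪_⟫ : Tm (num ∷ Γ) s → Tm Γ num → Tm Γ s
t ⟪ a ⟫ = subT (single a) t

wkT-⟪⟫ : (u : Tm Γ s) (a : Tm Γ num) → wkT u ⟪ a ⟫ ≡ u
wkT-⟪⟫ (var x)        a = refl
wkT-⟪⟫ zro            a = refl
wkT-⟪⟫ (suc u)        a = cong suc (wkT-⟪⟫ u a)
wkT-⟪⟫ (app1 f u)     a = cong₂ app1 (wkT-⟪⟫ f a) (wkT-⟪⟫ u a)
wkT-⟪⟫ (app2 f u q)   a
  rewrite wkT-⟪⟫ f a | wkT-⟪⟫ u a | wkT-⟪⟫ q a = refl
wkT-⟪⟫ (app3 f u q r) a
  rewrite wkT-⟪⟫ f a | wkT-⟪⟫ u a | wkT-⟪⟫ q a | wkT-⟪⟫ r a = refl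

hyp₀ : (A ∷ Φ) ⊢ A
hyp₀ = hyp (here refl)

hyp₁ : (B ∷ A ∷ Φ) ⊢ A
hyp₁ = hyp (there (here refl))

hyp₂ : (C ∷ B ∷ A ∷ Φ) ⊢ A
hyp₂ = hyp (there (there (here refl)))

hyp₃ : ∀ {D} → (D ∷ C ∷ B ∷ A ∷ Φ) ⊢ A
hyp₃ = hyp (there (there (there (here refl))))

hyp₄ : ∀ {D E} → (E ∷ D ∷ C ∷ B ∷ A ∷ Φ) ⊢ A
hyp₄ = hyp (there (there (there (there (here refl)))))

infixl 9 _·_
_·_ : ∀ {A : Fm (s ∷ Γ)} → Φ ⊢ all s A → (t : Tm Γ s) → Φ ⊢ A [ t ]
_·_ = ∀E

module _ {Φ : List (Fm Γ)} {a b : Tm Γ num} where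

  ≐-sym : Φ ⊢ a ≐ b → Φ ⊢ b ≐ a
  ≐-sym p = subst (λ t → Φ ⊢ b ≐ t) (wkT-⟪⟫ a b)
    (≐subst (v0 ≐ wkT a) p (subst (λ t → Φ ⊢ a ≐ t) (sym (wkT-⟪⟫ a a)) ≐refl))

  infixr 4 _⨾_
  _⨾_ : ∀ {c} → Φ ⊢ a ≐ b → Φ ⊢ b ≐ c → Φ ⊢ a ≐ c
  _⨾_ {c} p q = subst (λ t → Φ ⊢ t ≐ c) (wkT-⟪⟫ a c)
    (≐subst (wkT a ≐ v0) q (subst (λ t → Φ ⊢ t ≐ b) (sym (wkT-⟪⟫ a b)) p))

  ≐-cong : ∀ {c d} (C : Tm (num ∷ Γ) num) → C ⟪ a ⟫ ≡ c → C ⟪ b ⟫ ≡ d →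
           Φ ⊢ a ≐ b → Φ ⊢ c ≐ d
  ≐-cong C refl refl p = subst (λ t → Φ ⊢ t ≐ C ⟪ b ⟫) (wkT-⟪⟫ (C ⟪ a ⟫) b)
    (≐subst (wkT (C ⟪ a ⟫) ≐ C) p
      (subst (λ t → Φ ⊢ t ≐ C ⟪ a ⟫) (sym (wkT-⟪⟫ (C ⟪ a ⟫) a)) ≐refl))

  app1-cong : ∀ {f} → Φ ⊢ a ≐ b → Φ ⊢ app1 f a ≐ app1 f b
  app1-cong {f} = ≐-cong (app1 (wkT f) v0)
    (cong (λ g → app1 g a) (wkT-⟪⟫ f a)) (cong (λ g → app1 g b) (wkT-⟪⟫ f b))

app2-cong : ∀ {F a a′ b b′} → Φ ⊢ a ≐ a′ → Φ ⊢ b ≐ b′ → Φ ⊢ app2 F a b ≐ app2 F a′ b′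
app2-cong {F = F} {a} {a′} {b} {b′} p q =
  ≐-cong (app2 (wkT F) v0 (wkT b))
    (cong₂ (λ G c → app2 G a c) (wkT-⟪⟫ F a) (wkT-⟪⟫ b a))
    (cong₂ (λ G c → app2 G a′ c) (wkT-⟪⟫ F a′) (wkT-⟪⟫ b a′)) p
  ⨾ ≐-cong (app2 (wkT F) (wkT a′) v0)
    (cong₂ (λ G c → app2 G c b) (wkT-⟪⟫ F b) (wkT-⟪⟫ a′ b))
    (cong₂ (λ G c → app2 G c b′) (wkT-⟪⟫ F b′) (wkT-⟪⟫ a′ b′)) q

ignore-first-two : Φ ⊢ all fn1 (ex fn3 (all num (all num (all num (app3 v3 v2 v1 v0 ≐ app1 v4 v0)))))
ignore-first-two = ∀I
  (∃E (axiom compII · v0)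
  (∃E (axiom proj3)
  (∃E (axiom compV · v1 · v0 · v0 · v0)
  (∃I v0 (∀I (∀I (∀I
    (hyp₀ · v2 · v1 · v0
     ⨾ hyp₂ · app3 v4 v2 v1 v0 · app3 v4 v2 v1 v0 · app3 v4 v2 v1 v0
     ⨾ app1-cong (hyp₁ · v2 · v1 · v0)))))))))

swap₂ : Φ ⊢ all fn2 (ex fn3 (all num (all num (all num (app3 v3 v2 v1 v0 ≐ app2 v4 v1 v2)))))
swap₂ = ∀I
  (∃E (axiom compI · v0)
  (∃E (axiom proj1)
  (∃E (axiom proj2)
  (∃E (axiom proj3)
  (∃E (axiom compV · v3 · v1 · v2 · v0)
  (∃I v0 (∀I (∀I (∀I
    (hyp₀ · v2 · v1 · v0
     ⨾ hyp₄ · app3 v5 v2 v1 v0 · app3 v6 v2 v1 v0 · app3 v4 v2 v1 v0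
     ⨾ app2-cong (hyp₂ · v2 · v1 · v0) (hyp₃ · v2 · v1 · v0)))))))))))

fix-first : Φ ⊢ all fn2 (all num (ex fn1 (all num (app1 v1 v0 ≐ app2 v3 v2 v0))))
fix-first = ∀I (∀I
  (∃E (swap₂ · v1)
  (∃E (axiom compIV · v0 · v1 · zro)
  (∃I v0 (∀I (hyp₀ · v0 ⨾ hyp₁ · v0 · v3 · zro))))))

iteration-with-parameter :
  Φ ⊢ all num (all fn1 (ex fn2 (all num
        (app2 v1 v0 zro ≐ v3 ∧ all num (app2 v2 v1 (suc v0) ≐ app1 v3 (app2 v2 v1 v0))))))
iteration-with-parameter = ∀I (∀I
  (∃E (axiom const · v1)
  (∃E (ignore-first-two · v1)
  (∃E (axiom wpra · v1 · v0)
  (∃I v0 (∀I (∧I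
    (∧E₁ (hyp₀ · v0) ⨾ hyp₂ · v0)
    (∀I (∧E₂ (hyp₀ · v1) · v0 ⨾ hyp₁ · v1 · suc v0 · app2 v2 v1 v0)))))))))

lemma4 : Proves ITER
lemma4 = ∀I (∀I
  (∃E (iteration-with-parameter · v1 · v0)
  (∃E (fix-first · v0 · zro)
  (∃I v0 (∧I
    (hyp₀ · zro ⨾ ∧E₁ (hyp₁ · zro))
    (∀I (hyp₀ · suc v0 ⨾ ∧E₂ (hyp₁ · zro) · v0 ⨾ app1-cong (≐-sym (hyp₀ · v0)))))))))
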